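{- Let $\mathsf{APE}$ be the nonsymmetric sub-operad of $\mathsf{T}\mathbb{N}$ generated by the word $01$. Then the elements of $\mathsf{APE}$ of arity $n$ are exactly the words $x=(x_1,\dots,x_n)$ over $\mathbb{N}$ satisfying $x_1=0$ and $1\le x_{i+1}\le x_i+1$ for all $1\le i\le n-1$. Moreover, for every $n\ge1$, the elements of $\mathsf{APE}$ of arity $n$ are in bijection with rooted plane trees with $n$ nodes. Finally, $\mathsf{APE}$ is isomorphic to the free nonsymmetric operad on one generator of arity two.
   Context: $\mathbb{N}$ denotes the additive monoid of nonnegative integers. $\mathsf{T}\mathbb{N} := \biguplus_{n\ge1}\mathbb{N}^n$ is the set of nonempty words over $\mathbb{N}$, a word of length $n$ having arity $n$, with partial compositions $x\circ_i y := (x_1,\dots,x_{i-1}, x_i+y_1,\dots,x_i+y_m, x_{i+1},\dots,x_n)$ for $x$ of length $n$, $y$ of length $m$, $1\le i\le n$; its unit is the word $0$ of length $1$. The nonsymmetric sub-operad generated by a set $G$ of words is the smallest subset of $\mathsf{T}\mathbb{N}$ containing $G$ and the unit and closed under all partial compositions $\circ_i$. -}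

module Defs where

open import Data.Nat using (ℕ; zero; suc; _+_; _≤_)
open import Data.Fin using (Fin; zero; suc; cast; splitAt)
open import Data.Sum using (inj₁; inj₂)
open import Data.List using (List; []; _∷_; _++_; map; length)
open import Data.List.Relation.Unary.Linked using (Linked)
open import Data.Product using (Σ; _×_; ∃)
open import Relation.Binary.PropositionalEquality using (_≡_; sym)

-- Words over ℕ (elements of TN are the nonempty ones); arity = length.
Word : Set
Word = List ℕ

-- Partial composition x ∘_i y, with i a 0-based position in x
-- (the paper's ∘_{i+1}):  (x_1..x_{i}, x_{i+1}+y_1, ..., x_{i+1}+y_m, x_{i+2}..x_n)
_∘⟨_⟩_ : (x : Word) → Fin (length x) → Word → Word
(a ∷ x) ∘⟨ zero ⟩ y = map (a +_) y ++ x
(a ∷ x) ∘⟨ suc i ⟩ y = a ∷ (x ∘⟨ i ⟩ y)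

data InAPE : Word → Set where
  unit : InAPE (0 ∷ [])
  gen  : InAPE (0 ∷ 1 ∷ [])
  comp : ∀ {x y} (i : Fin (length x)) → InAPE x → InAPE y → InAPE (x ∘⟨ i ⟩ y)

StepOK : ℕ → ℕ → Set
StepOK a b = 1 ≤ b × b ≤ a + 1

IsAPEWord : Word → Set
IsAPEWord x = Σ Word (λ t → x ≡ 0 ∷ t) × Linked StepOK x

data PlaneTree : Set where
  node : List PlaneTree → PlaneTree

mutual
  nodes : PlaneTree → ℕ
  nodes (node ts) = suc (nodesF ts)

  nodesF : List PlaneTree → ℕ
  nodesF [] = 0
  nodesF (t ∷ ts) = nodes t + nodesF ts

-- A bijection between A and the subset {x | P x} of B (membership P may be
-- proof-relevant, so the bijection is stated on underlying elements).
record BijOnto {A B : Set} (f : A → B) (P : B → Set) : Set where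
  field
    into     : ∀ a → P (f a)
    injective : ∀ a a' → f a ≡ f a' → a ≡ a'
    onto     : ∀ b → P b → ∃ λ a → f a ≡ b

-- The free nonsymmetric operad on one generator of arity two:
-- binary trees, arity = number of leaves, unit = leaf, generator = bin leaf leaf,
-- partial composition = grafting onto the i-th leaf (0-based, left to right).
data BinTree : Set where
  leaf : BinTree
  bin  : BinTree → BinTree → BinTree

leaves : BinTree → ℕ
leaves leaf = 1
leaves (bin l r) = leaves l + leaves r

graft : (t : BinTree) → Fin (leaves t) → BinTree → BinTree
graft leaf zero s = s
graft (bin l r) i s with splitAt (leaves l) i
... | inj₁ j = bin (graft l j s) r
... | inj₂ j = bin l (graft r j s)

record IsOperadIso (φ : BinTree → Word) : Set where
  field
    arity    : ∀ t → length (φ t) ≡ leaves t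
    bij      : BijOnto φ InAPE
    unitPres : φ leaf ≡ 0 ∷ []
    compPres : ∀ t (i : Fin (leaves t)) s →
               φ (graft t i s) ≡ (φ t ∘⟨ cast (sym (arity t)) i ⟩ φ s)

module Submission where

-- By compatibility with the operad structure, an isomorphism
-- from binary trees to APE is forced to send the generator to 01 and a tree
-- bin l r to (01 ∘₂ φ r) ∘₁ φ l = φ l ++ map suc (φ r)  (1-based positions;
-- the formal ∘⟨_⟩ counts from 0).  Writing φ t = 0 ∷ w t,
-- this is the "tail word" recursion  w (bin l r) = w l ++ 1 ∷ map suc (w r).
--
-- Next, the APE words are characterised through their
-- tails: a nonempty tail ρ (i.e. 0 ∷ ρ is an APE word) splits uniquely at
-- the last occurrence of the letter 1 as ρ = α ++ 1 ∷ map suc γ with α, γ again tails.  This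
-- decomposition inverts the recursion for w, so φ is a bijection from
-- binary trees onto the APE words.  Finally the rotation correspondence
-- between plane forests and binary trees transports this to plane trees.

open import Defs
open import Data.Nat using (ℕ; zero; suc; _≤_; _+_; z≤n; s≤s; _≟_)
open import Data.Nat.Properties
  using (≤-refl; ≤-antisym; m≤n+m; +-suc; ≡-irrelevant; suc-injective; m+n≤o⇒m≤o; m+n≤o⇒n≤o)
open import Data.Maybe using (Maybe; just; nothing)
open import Data.Maybe.Relation.Binary.Connected using (Connected; just; nothing-just)
open import Data.List using (List; []; _∷_; _++_; map; length; last)
open import Data.List.Properties
  using (map-∘; map-++; length-map; length-++; ++-identityʳ; ++-assoc; map-id; map-injective; ∷-injective)
open import Data.List.Relation.Unary.Any using (here; there)
open import Data.List.Relation.Unary.Linked using (Linked; []; [-]; _∷_)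
import Data.List.Relation.Unary.Linked as Linked
open import Data.List.Relation.Unary.Linked.Properties using (++⁺; map⁺)
open import Data.List.Membership.Propositional using (_∈_; _∉_)
open import Data.List.Membership.Propositional.Properties using (∈-++⁺ʳ)
import Data.List.Membership.DecPropositional as DecMembership
open import Data.Fin using (Fin; zero; suc; toℕ; cast; splitAt)
open import Data.Fin.Properties using (toℕ-injective; toℕ-cast; toℕ-↑ˡ; toℕ-↑ʳ; splitAt⁻¹-↑ˡ; splitAt⁻¹-↑ʳ)
open import Data.Sum using (inj₁; inj₂)
open import Data.Product using (Σ; _×_; ∃; ∃₂; _,_; proj₂)
open import Data.Empty using (⊥-elim)
open import Relation.Nullary using (yes; no)
open import Relation.Binary.Definitions using (DecidableEquality)
open import Function using (_∘_)
open import Function.Bundles using (_⇔_; mk⇔)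
open import Relation.Binary.PropositionalEquality
  using (_≡_; _≢_; refl; sym; trans; cong; cong₂; subst; module ≡-Reasoning)

-- Partial composition versus concatenation and shifting.  Positions are
-- related through toℕ, since they live in Fin types of different lengths.

∘-++ˡ : ∀ x z (j : Fin (length x)) y (k : Fin (length (x ++ z))) → toℕ k ≡ toℕ j →
        (x ++ z) ∘⟨ k ⟩ y ≡ (x ∘⟨ j ⟩ y) ++ z
∘-++ˡ (a ∷ x) z zero    y zero    _ = sym (++-assoc (map (a +_) y) x z)
∘-++ˡ (a ∷ x) z (suc j) y (suc k) e = cong (a ∷_) (∘-++ˡ x z j y k (suc-injective e))

∘-++ʳ : ∀ x z (j : Fin (length z)) y (k : Fin (length (x ++ z))) → toℕ k ≡ length x + toℕ j →
        (x ++ z) ∘⟨ k ⟩ y ≡ x ++ (z ∘⟨ j ⟩ y)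
∘-++ʳ []      z j y k       e = cong (λ i → z ∘⟨ i ⟩ y) (toℕ-injective e)
∘-++ʳ (a ∷ x) z j y (suc k) e = cong (a ∷_) (∘-++ʳ x z j y k (suc-injective e))

∘-map-suc : ∀ z (j : Fin (length z)) y (k : Fin (length (map suc z))) → toℕ k ≡ toℕ j →
            map suc z ∘⟨ k ⟩ y ≡ map suc (z ∘⟨ j ⟩ y)
∘-map-suc (a ∷ z) zero    y zero    _ =
  trans (cong (_++ map suc z) (map-∘ y)) (sym (map-++ suc (map (a +_) y) z))
∘-map-suc (a ∷ z) (suc j) y (suc k) e = cong (suc a ∷_) (∘-map-suc z j y k (suc-injective e))

tailWord : BinTree → List ℕ
tailWord leaf      = []
tailWord (bin l r) = tailWord l ++ 1 ∷ map suc (tailWord r)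

word : BinTree → Word
word t = 0 ∷ tailWord t

length-word : ∀ t → length (word t) ≡ leaves t
length-word leaf      = refl
length-word (bin l r) = trans (length-++ (word l) {map suc (word r)})
  (cong₂ _+_ (length-word l) (trans (length-map suc (word r)) (length-word r)))

word-graft : ∀ t (i : Fin (leaves t)) s (k : Fin (length (word t))) → toℕ k ≡ toℕ i →
             word (graft t i s) ≡ (word t ∘⟨ k ⟩ word s)
word-graft leaf      zero s zero _ = sym (trans (++-identityʳ (map (0 +_) (word s))) (map-id (word s)))
word-graft (bin l r) i    s k    e with splitAt (leaves l) i in split
... | inj₁ j = begin
    word (graft l j s) ++ map suc (word r)
      ≡⟨ cong (_++ map suc (word r)) (word-graft l j s j′ (toℕ-cast _ j)) ⟩
    (word l ∘⟨ j′ ⟩ word s) ++ map suc (word r)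
      ≡⟨ sym (∘-++ˡ (word l) (map suc (word r)) j′ (word s) k k≡j′) ⟩
    word (bin l r) ∘⟨ k ⟩ word s ∎
  where
  open ≡-Reasoning
  j′ : Fin (length (word l))
  j′ = cast (sym (length-word l)) j
  k≡j′ : toℕ k ≡ toℕ j′
  k≡j′ = trans e (trans (cong toℕ (sym (splitAt⁻¹-↑ˡ split)))
                  (trans (toℕ-↑ˡ j (leaves r)) (sym (toℕ-cast _ j))))
... | inj₂ j = begin
    word l ++ map suc (word (graft r j s))
      ≡⟨ cong (λ w → word l ++ map suc w) (word-graft r j s j′ (toℕ-cast _ j)) ⟩
    word l ++ map suc (word r ∘⟨ j′ ⟩ word s)
      ≡⟨ cong (word l ++_) (sym (∘-map-suc (word r) j′ (word s) j″ (toℕ-cast _ j′))) ⟩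
    word l ++ (map suc (word r) ∘⟨ j″ ⟩ word s)
      ≡⟨ sym (∘-++ʳ (word l) (map suc (word r)) j″ (word s) k k≡l+j″) ⟩
    word (bin l r) ∘⟨ k ⟩ word s ∎
  where
  open ≡-Reasoning
  j′ : Fin (length (word r))
  j′ = cast (sym (length-word r)) j
  j″ : Fin (length (map suc (word r)))
  j″ = cast (sym (length-map suc (word r))) j′
  k≡l+j″ : toℕ k ≡ length (word l) + toℕ j″
  k≡l+j″ = trans e (trans (cong toℕ (sym (splitAt⁻¹-↑ʳ split)))
             (trans (toℕ-↑ʳ (leaves l) j)
               (cong₂ _+_ (sym (length-word l)) (sym (trans (toℕ-cast _ j′) (toℕ-cast _ j))))))

-- Every word (bin l r) is obtained as (01 ∘₂ word r) ∘₁ word l.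
word∈APE : ∀ t → InAPE (word t)
word∈APE leaf      = unit
word∈APE (bin l r) =
  subst InAPE shape (comp zero (comp (suc zero) gen (word∈APE r)) (word∈APE l))
  where
  shape : map (0 +_) (word l) ++ (map (1 +_) (word r) ++ []) ≡ word l ++ map suc (word r)
  shape = cong₂ _++_ (map-id (word l)) (++-identityʳ (map suc (word r)))

-- The image of word is closed under composition, so it contains APE.
APE⊆image : ∀ x → InAPE x → ∃ λ t → word t ≡ x
APE⊆image _ unit = leaf , refl
APE⊆image _ gen  = bin leaf leaf , refl
APE⊆image _ (comp {x} {y} i x∈ y∈) with APE⊆image x x∈ | APE⊆image y y∈
... | t , refl | s , refl =
  graft t (cast (length-word t) i) s , word-graft t (cast (length-word t) i) s i (sym (toℕ-cast _ i))

split-unique : ∀ {A : Set} {a : A} xs xs′ {ys ys′} → a ∉ ys → a ∉ ys′ →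
               xs ++ a ∷ ys ≡ xs′ ++ a ∷ ys′ → xs ≡ xs′ × ys ≡ ys′
split-unique []       []        _    _     e = refl , proj₂ (∷-injective e)
split-unique []       (b ∷ xs′) a∉ys _     e with ∷-injective e
... | _ , ys≡ = ⊥-elim (a∉ys (subst (_ ∈_) (sym ys≡) (∈-++⁺ʳ xs′ (here refl))))
split-unique (b ∷ xs) []        _    a∉ys′ e with ∷-injective e
... | _ , ≡ys′ = ⊥-elim (a∉ys′ (subst (_ ∈_) ≡ys′ (∈-++⁺ʳ xs (here refl))))
split-unique (b ∷ xs) (b′ ∷ xs′) a∉ys a∉ys′ e with ∷-injective e
... | refl , e′ with split-unique xs xs′ a∉ys a∉ys′ e′
... | refl , refl = refl , refl

module _ {A : Set} (_≟ᴬ_ : DecidableEquality A) where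
  open DecMembership _≟ᴬ_ using (_∈?_)

  split-last : ∀ (a : A) xs → a ∈ xs → ∃₂ λ α β → xs ≡ α ++ a ∷ β × a ∉ β
  split-last a (b ∷ xs) a∈ with a ∈? xs
  ... | yes a∈xs with split-last a xs a∈xs
  ...   | α , β , e , a∉β = b ∷ α , β , cong (b ∷_) e , a∉β
  split-last a (b ∷ xs) (here refl) | no a∉xs = [] , xs , refl , a∉xs
  split-last a (b ∷ xs) (there a∈xs) | no a∉xs = ⊥-elim (a∉xs a∈xs)

APETail : List ℕ → Set
APETail ρ = Linked StepOK (0 ∷ ρ)

Linked-++⁻ : ∀ {A : Set} {R : A → A → Set} xs {ys} → Linked R (xs ++ ys) → Linked R xs × Linked R ys
Linked-++⁻ []           lk       = [] , lk
Linked-++⁻ (x ∷ [])     lk       = [-] , Linked.tail lk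
Linked-++⁻ (x ∷ y ∷ xs) (r ∷ lk) with Linked-++⁻ (y ∷ xs) lk
... | lk₁ , lk₂ = r ∷ lk₁ , lk₂

step-to-1 : ∀ (m : Maybe ℕ) → Connected StepOK m (just 1)
step-to-1 (just a) = just (s≤s z≤n , m≤n+m 1 a)
step-to-1 nothing  = nothing-just

step-suc : ∀ {a b} → StepOK a b → StepOK (suc a) (suc b)
step-suc (_ , b≤a+1) = s≤s z≤n , s≤s b≤a+1

join-tails : ∀ α γ → APETail α → APETail γ → APETail (α ++ 1 ∷ map suc γ)
join-tails α γ lkα lkγ = ++⁺ lkα (step-to-1 (last (0 ∷ α))) (map⁺ (Linked.map step-suc lkγ))

-- The letters after a step are ≥ 1, so none of them equals 1 once shifted.
1∉shifted : ∀ {a} γ → Linked StepOK (a ∷ γ) → 1 ∉ map suc γ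
1∉shifted (zero ∷ γ)  ((() , _) ∷ _)
1∉shifted (suc b ∷ γ) (_ ∷ lk) (there 1∈) = 1∉shifted γ lk 1∈

unshift : ∀ {a} β → 1 ∉ β → Linked StepOK (suc a ∷ β) →
          ∃ λ γ → β ≡ map suc γ × Linked StepOK (a ∷ γ)
unshift []                _   _ = [] , refl , [-]
unshift (zero ∷ β)        _   ((() , _) ∷ _)
unshift (suc zero ∷ β)    1∉β _ = ⊥-elim (1∉β (here refl))
unshift (suc (suc c) ∷ β) 1∉β ((_ , s≤s c≤a+1) ∷ lk) with unshift β (1∉β ∘ there) lk
... | γ , refl , lk′ = suc c ∷ γ , refl , (s≤s z≤n , c≤a+1) ∷ lk′

split-tail : ∀ b ρ → APETail (b ∷ ρ) →
             ∃₂ λ α γ → b ∷ ρ ≡ α ++ 1 ∷ map suc γ × APETail α × APETail γ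
split-tail b ρ lk@((1≤b , b≤1) ∷ _)
  with split-last _≟_ 1 (b ∷ ρ) (here (≤-antisym 1≤b b≤1))
... | α , β , ρ≡ , 1∉β with Linked-++⁻ (0 ∷ α) (subst APETail ρ≡ lk)
... | lkα , lk1β with unshift β 1∉β lk1β
... | γ , refl , lkγ = α , γ , ρ≡ , lkα , lkγ

-- Only the leaf has the empty tail word.
++-∷-nonempty : ∀ {A : Set} xs {y : A} {ys} → xs ++ y ∷ ys ≢ []
++-∷-nonempty []      ()
++-∷-nonempty (_ ∷ _) ()

tailWord-tail : ∀ t → APETail (tailWord t)
tailWord-tail leaf      = [-]
tailWord-tail (bin l r) = join-tails (tailWord l) (tailWord r) (tailWord-tail l) (tailWord-tail r)

-- Uniqueness of the split at the last 1 makes tailWord injective.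
tailWord-injective : ∀ t t′ → tailWord t ≡ tailWord t′ → t ≡ t′
tailWord-injective leaf      leaf        _ = refl
tailWord-injective leaf      (bin l r)   e = ⊥-elim (++-∷-nonempty (tailWord l) (sym e))
tailWord-injective (bin l r) leaf        e = ⊥-elim (++-∷-nonempty (tailWord l) e)
tailWord-injective (bin l r) (bin l′ r′) e
  with split-unique (tailWord l) (tailWord l′)
         (1∉shifted (tailWord r) (tailWord-tail r)) (1∉shifted (tailWord r′) (tailWord-tail r′)) e
... | l≡ , r≡ = cong₂ bin (tailWord-injective l l′ l≡)
                          (tailWord-injective r r′ (map-injective suc-injective r≡))

word-injective : ∀ t t′ → word t ≡ word t′ → t ≡ t′
word-injective t t′ e = tailWord-injective t t′ (proj₂ (∷-injective e))

split-shorter : ∀ α γ {n} → length (α ++ 1 ∷ map suc γ) ≤ suc n → length α ≤ n × length γ ≤ n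
split-shorter α γ {n} len = m+n≤o⇒m≤o (length α) α+γ≤n , m+n≤o⇒n≤o (length α) α+γ≤n
  where
  open ≡-Reasoning
  length-split : length (α ++ 1 ∷ map suc γ) ≡ suc (length α + length γ)
  length-split = begin
    length (α ++ 1 ∷ map suc γ)            ≡⟨ length-++ α ⟩
    length α + suc (length (map suc γ))    ≡⟨ cong (λ m → length α + suc m) (length-map suc γ) ⟩
    length α + suc (length γ)              ≡⟨ +-suc (length α) (length γ) ⟩
    suc (length α + length γ)              ∎
  α+γ≤n : length α + length γ ≤ n
  α+γ≤n with s≤s le ← subst (_≤ suc n) length-split len = le

-- Every tail is a tailWord: invert the recursion by split-tail, with
-- the length bound n as termination measure.
decode : ∀ n ρ → length ρ ≤ n → APETail ρ → ∃ λ t → tailWord t ≡ ρ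
decode _       []      _   _  = leaf , refl
decode (suc n) (b ∷ ρ) len lk with split-tail b ρ lk
... | α , γ , ρ≡ , lkα , lkγ with split-shorter α γ (subst (λ w → length w ≤ suc n) ρ≡ len)
... | α≤n , γ≤n with decode n α α≤n lkα | decode n γ γ≤n lkγ
... | l , refl | r , refl = bin l r , sym ρ≡

APE⇔APEWord : ∀ x → InAPE x ⇔ IsAPEWord x
APE⇔APEWord x = mk⇔ to from
  where
  to : InAPE x → IsAPEWord x
  to x∈ with APE⊆image x x∈
  ... | t , refl = (tailWord t , refl) , tailWord-tail t
  from : IsAPEWord x → InAPE x
  from ((ρ , refl) , lk) with decode (length ρ) ρ ≤-refl lk
  ... | t , refl = word∈APE t

word-bijOnto : BijOnto word InAPE
word-bijOnto = record { into = word∈APE ; injective = word-injective ; onto = APE⊆image }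

-- Rotation correspondence: plane forests with n nodes are binary trees
-- with n + 1 leaves (first child becomes left subtree, next sibling right).
toBin : List PlaneTree → BinTree
toBin []              = leaf
toBin (node ts ∷ ts′) = bin (toBin ts) (toBin ts′)

fromBin : BinTree → List PlaneTree
fromBin leaf      = []
fromBin (bin l r) = node (fromBin l) ∷ fromBin r

fromBin-toBin : ∀ ts → fromBin (toBin ts) ≡ ts
fromBin-toBin []              = refl
fromBin-toBin (node ts ∷ ts′) = cong₂ (λ a b → node a ∷ b) (fromBin-toBin ts) (fromBin-toBin ts′)

toBin-fromBin : ∀ t → toBin (fromBin t) ≡ t
toBin-fromBin leaf      = refl
toBin-fromBin (bin l r) = cong₂ bin (toBin-fromBin l) (toBin-fromBin r)

leaves-toBin : ∀ ts → leaves (toBin ts) ≡ suc (nodesF ts)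
leaves-toBin []              = refl
leaves-toBin (node ts ∷ ts′) =
  trans (cong₂ _+_ (leaves-toBin ts) (leaves-toBin ts′)) (+-suc (suc (nodesF ts)) (nodesF ts′))

children : PlaneTree → List PlaneTree
children (node ts) = ts

-- A plane tree with n nodes is a root over a forest with n - 1 nodes, so it
-- corresponds to a binary tree with n leaves, hence to an APE word of length n.
planeTreeWord : ∀ {n} → Σ PlaneTree (λ t → nodes t ≡ n) → Word
planeTreeWord (t , _) = word (toBin (children t))

planeTreeWord-bijOnto : ∀ n → BijOnto (planeTreeWord {n}) (λ x → InAPE x × length x ≡ n)
planeTreeWord-bijOnto n = record { into = into ; injective = injective ; onto = onto }
  where
  into : ∀ t → InAPE (planeTreeWord t) × length (planeTreeWord t) ≡ n
  into (node ts , size) = word∈APE (toBin ts) , trans (length-word (toBin ts)) (trans (leaves-toBin ts) size)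
  injective : ∀ t t′ → planeTreeWord t ≡ planeTreeWord t′ → t ≡ t′
  injective (node ts , size) (node ts′ , size′) e
    with refl ← trans (sym (fromBin-toBin ts)) (trans (cong fromBin (word-injective _ _ e)) (fromBin-toBin ts′))
    = cong (node ts ,_) (≡-irrelevant size size′)
  onto : ∀ x → InAPE x × length x ≡ n → ∃ λ t → planeTreeWord t ≡ x
  onto x (x∈ , len) with APE⊆image x x∈
  ... | b , refl = (node (fromBin b) , size) , cong word (toBin-fromBin b)
    where
    size : nodes (node (fromBin b)) ≡ n
    size = begin
      suc (nodesF (fromBin b))  ≡⟨ sym (leaves-toBin (fromBin b)) ⟩
      leaves (toBin (fromBin b)) ≡⟨ cong leaves (toBin-fromBin b) ⟩
      leaves b                   ≡⟨ sym (length-word b) ⟩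
      length (word b)            ≡⟨ len ⟩
      n                          ∎
      where open ≡-Reasoning

word-isOperadIso : IsOperadIso word
word-isOperadIso = record
  { arity    = length-word
  ; bij      = word-bijOnto
  ; unitPres = refl
  ; compPres = λ t i s → word-graft t i s (cast (sym (length-word t)) i) (toℕ-cast _ i)
  }

mainTheorem3 :
    (∀ (x : Word) → InAPE x ⇔ IsAPEWord x)
    × (∀ (n : ℕ) → 1 ≤ n →
        ∃ λ (f : Σ PlaneTree (λ t → nodes t ≡ n) → Word) →
          BijOnto f (λ x → InAPE x × length x ≡ n))
    × (∃ λ (φ : BinTree → Word) → IsOperadIso φ)
mainTheorem3 =
    APE⇔APEWord
  , (λ n _ → planeTreeWord , planeTreeWord-bijOnto n)
  , (word , word-isOperadIso)
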